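{- Let $k\ge 1$ and $0\le t\le k$ be fixed integers and let $n\ge 1$. Then: (1) $s_{n,t,0}=\sum_{j=0}^{t-1} C_{n,j}$. (2) $s_{n,0,1}=\sum_{j=0}^{k-1} C_{n-1,j}=\frac{k}{n}\binom{(k+1)(n-1)}{n-1}$. (3) For every integer $r$ with $1\le r\le n$, \[ s_{n,t,r}=s_{n,t,r-1}+C_{r,t}\bigl(s_{n-r+1,0,1}-t\,[r=n]\bigr), \] where $[r=n]$ equals $1$ if $r=n$ and $0$ otherwise.
   Context: For a positive integer $k$ and an integer $t$ with $0\le t\le k$, a $k_t$-Dyck path is a lattice path consisting of up-steps $(1,k)$ and down-steps $(1,-1)$ that starts at $(0,0)$, stays weakly above the line $y=-t$, and ends on the line $y=0$; if it has $n$ up-steps it has $kn$ down-steps and length $(k+1)n$. For $n\ge 1$ and $0\le r\le n$, $s_{n,t,r}$ denotes the total number, summed over all $k_t$-Dyck paths with $n$ up-steps, of down-steps lying between the $r$-th and the $(r+1)$-th up-step (for $r=0$: the down-steps before the first up-step; for $r=n$: the down-steps after the last up-step). For integers $n,j\ge 0$ set $C_{n,j}=\frac{j+1}{(k+1)n+j+1}\binom{(k+1)n+j+1}{n}$. -}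

module Defs where

open import Data.Bool using (Bool; true; false; if_then_else_; _∧_)
open import Data.Nat using (ℕ; zero; suc; _+_; _*_; _∸_; _/_; _≡ᵇ_)
open import Data.Nat.Combinatorics using (_C_)
open import Data.List using (List; []; _∷_; map; upTo; concatMap)
open import Data.Nat.ListAction using (sum)

-- Steps of a k_t-Dyck path: up-step (1,k), down-step (1,-1).
data Step : Set where
  up down : Step

words : ℕ → List (List Step)
words zero = [] ∷ []
words (suc L) = concatMap (λ w → (up ∷ w) ∷ (down ∷ w) ∷ []) (words L)

ups : List Step → ℕ
ups [] = 0
ups (up ∷ p) = suc (ups p)
ups (down ∷ p) = ups p

-- walkOK k t h p : walking p from shifted height h (actual height = h - t),
-- never goes below actual height -t (shifted height 0) and ends at actual height 0.
walkOK : ℕ → ℕ → ℕ → List Step → Bool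
walkOK k t h [] = h ≡ᵇ t
walkOK k t h (up ∷ p) = walkOK k t (h + k) p
walkOK k t zero (down ∷ p) = false
walkOK k t (suc h) (down ∷ p) = walkOK k t h p

isDyck : ℕ → ℕ → ℕ → List Step → Bool
isDyck k t n p = walkOK k t t p ∧ (ups p ≡ᵇ n)

-- gap r p : number of down-steps between the r-th and (r+1)-th up-step
-- (r = 0: before the first up-step; r = #ups: after the last up-step).
gap : ℕ → List Step → ℕ
gap r [] = 0
gap zero (up ∷ p) = 0
gap zero (down ∷ p) = suc (gap zero p)
gap (suc r) (up ∷ p) = gap r p
gap (suc r) (down ∷ p) = gap (suc r) p

-- s k n t r = s_{n,t,r}: total of gap r over all k_t-Dyck paths with n up-steps
-- (such paths have length (k+1)n).
s : ℕ → ℕ → ℕ → ℕ → ℕ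
s k n t r = sum (map (λ p → if isDyck k t n p then gap r p else 0) (words ((suc k) * n)))

-- C k n j = C_{n,j} = (j+1)/((k+1)n+j+1) * binom((k+1)n+j+1, n)
-- (an integer; computed as exact division of the product).
Cnj : ℕ → ℕ → ℕ → ℕ
Cnj k n j = ((suc j) * ((suc ((suc k) * n + j)) C n)) / suc ((suc k) * n + j)

sumBelow : ℕ → (ℕ → ℕ) → ℕ
sumBelow m f = sum (map f (upTo m))

iver : ℕ → ℕ → ℕ
iver a b = if a ≡ᵇ b then 1 else 0

module Submission where

open import Defs
open import Data.Bool using (Bool; true; false; if_then_else_; _∧_)
open import Data.Nat using (ℕ; zero; suc; _+_; _*_; _∸_; _/_; _≤_; NonZero; _≡ᵇ_; z≤n; s≤s)
open import Data.Nat.Properties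
open import Data.Nat.Combinatorics using (_C_; nCk+nC[k+1]≡[n+1]C[k+1])
open import Data.Nat.DivMod using (m*n/n≡m)
open import Data.Nat.ListAction using (sum)
open import Data.Nat.ListAction.Properties using (sum-++)
open import Data.Nat.Tactic.RingSolver using (solve-∀)
open import Data.List using (List; []; _∷_; _∷ʳ_; map; upTo; concatMap)
open import Data.List.Properties using (map-++; map-cong; upTo-∷ʳ)
open import Data.Integer using (ℤ; +_) renaming (_+_ to _+ℤ_; _*_ to _*ℤ_; _-_ to _-ℤ_)
import Data.Integer.Properties as ℤ
import Data.Integer.Tactic.RingSolver as ℤ-Solver
open import Data.Empty using (⊥; ⊥-elim)
open import Data.Product using (_×_; _,_)
open import Relation.Binary.PropositionalEquality

-- Measure heights from the floor y = -t, so that paths start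
-- and end at height t.  Splitting by the first step (down to h-1, or up to
-- h+k), the number of admissible walks from height h with m up-steps is the
-- number  ballot m h  of a first-step recursion, and their total r-th gap is
-- gapTable r m h, up to a correction for the last gap, which gapTable
-- measures down to the floor.  Both facts are checked against the brute-force
-- definition of s by induction on the length (count-walks, count-gaps), after
-- which the theorem is algebra on these numbers:
--   * ballot m j = C_{m,j}, via the difference form
--     C_{m+1,h} = binom((k+1)(m+1)+h, m+1) - k binom((k+1)(m+1)+h, m);
--   * prefix sums of difference forms telescope, which gives part (2);
--   * gapTable (r+1) n h = gapTable r n h + ballot (r+1) h Σ_{j<k} C_{n-r-1,j},
--     which is part (3) once the floor correction is removed.

sum-map-+ : {A : Set} (f g : A → ℕ) (xs : List A) →
            sum (map (λ x → f x + g x) xs) ≡ sum (map f xs) + sum (map g xs)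
sum-map-+ f g [] = refl
sum-map-+ f g (x ∷ xs) = begin
    f x + g x + sum (map (λ x → f x + g x) xs)
  ≡⟨ cong (λ z → f x + g x + z) (sum-map-+ f g xs) ⟩
    f x + g x + (sum (map f xs) + sum (map g xs))
  ≡⟨ interchange (f x) (g x) _ _ ⟩
    f x + sum (map f xs) + (g x + sum (map g xs)) ∎
  where
  open ≡-Reasoning
  interchange : ∀ a b c d → a + b + (c + d) ≡ a + c + (b + d)
  interchange = solve-∀

sum-map-concatMap-pair : {A B : Set} (f : B → ℕ) (a b : A → B) (xs : List A) →
  sum (map f (concatMap (λ x → a x ∷ b x ∷ []) xs)) ≡ sum (map (λ x → f (a x) + f (b x)) xs)
sum-map-concatMap-pair f a b [] = refl
sum-map-concatMap-pair f a b (x ∷ xs) =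
  trans (cong (λ z → f (a x) + (f (b x) + z)) (sum-map-concatMap-pair f a b xs))
        (sym (+-assoc (f (a x)) (f (b x)) _))

sumWords : ℕ → (List Step → ℕ) → ℕ
sumWords L f = sum (map f (words L))

sumWords-step : ∀ L (f : List Step → ℕ) →
                sumWords (suc L) f ≡ sumWords L (λ w → f (up ∷ w) + f (down ∷ w))
sumWords-step L f = sum-map-concatMap-pair f (up ∷_) (down ∷_) (words L)

sumWords-+ : ∀ L (f g : List Step → ℕ) →
             sumWords L (λ w → f w + g w) ≡ sumWords L f + sumWords L g
sumWords-+ L f g = sum-map-+ f g (words L)

sumWords-cong : ∀ L {f g : List Step → ℕ} → (∀ w → f w ≡ g w) → sumWords L f ≡ sumWords L g
sumWords-cong L eq = cong sum (map-cong eq (words L))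

sumWords-zero : ∀ L → sumWords L (λ _ → 0) ≡ 0
sumWords-zero L = all-zero (words L)
  where
  all-zero : (ws : List (List Step)) → sum (map (λ _ → 0) ws) ≡ 0
  all-zero [] = refl
  all-zero (_ ∷ ws) = all-zero ws

sumBelow-suc : ∀ h (f : ℕ → ℕ) → sumBelow (suc h) f ≡ sumBelow h f + f h
sumBelow-suc h f = begin
    sum (map f (upTo (suc h)))
  ≡⟨ cong (λ xs → sum (map f xs)) (sym (upTo-∷ʳ h)) ⟩
    sum (map f (upTo h ∷ʳ h))
  ≡⟨ cong sum (map-++ f (upTo h) (h ∷ [])) ⟩
    sum (map f (upTo h) ∷ʳ f h)
  ≡⟨ sum-++ (map f (upTo h)) (f h ∷ []) ⟩
    sumBelow h f + (f h + 0)
  ≡⟨ cong (λ z → sumBelow h f + z) (+-identityʳ (f h)) ⟩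
    sumBelow h f + f h ∎
  where open ≡-Reasoning

guarded : Bool → ℕ → ℕ
guarded b x = if b then x else 0

guarded-zero : ∀ b → guarded b 0 ≡ 0
guarded-zero true = refl
guarded-zero false = refl

guarded-∧-false : ∀ b x → guarded (b ∧ false) x ≡ 0
guarded-∧-false true x = refl
guarded-∧-false false x = refl

guarded-suc : ∀ b x → guarded b (suc x) ≡ guarded b 1 + guarded b x
guarded-suc true x = refl
guarded-suc false x = refl

guarded-+ : ∀ b x y → guarded b (x + y) ≡ guarded b x + guarded b y
guarded-+ true x y = refl
guarded-+ false x y = refl

guarded-* : ∀ b t c → guarded b (t * c) ≡ t * (if b then 1 else 0) * c
guarded-* true t c = cong (_* c) (sym (*-identityʳ t))
guarded-* false t c = cong (_* c) (sym (*-zeroʳ t))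

≡ᵇ-refl : ∀ n → (n ≡ᵇ n) ≡ true
≡ᵇ-refl zero = refl
≡ᵇ-refl (suc n) = ≡ᵇ-refl n

-- Binomial coefficients by Pascal's rule, which computes by pattern matching.
binom : ℕ → ℕ → ℕ
binom n zero = 1
binom zero (suc j) = 0
binom (suc n) (suc j) = binom n j + binom n (suc j)

binom≡C : ∀ n j → binom n j ≡ n C j
binom≡C zero zero = refl
binom≡C (suc n) zero = refl
binom≡C zero (suc j) = refl
binom≡C (suc n) (suc j) =
  trans (cong₂ _+_ (binom≡C n j) (binom≡C n (suc j))) (nCk+nC[k+1]≡[n+1]C[k+1] n j)

binom-1 : ∀ n → binom n 1 ≡ n
binom-1 zero = refl
binom-1 (suc n) = cong suc (binom-1 n)

binom-absorb : ∀ n j → suc j * binom (suc n) (suc j) ≡ suc n * binom n j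
binom-absorb n zero = trans (*-identityˡ _) (trans (binom-1 (suc n)) (sym (*-identityʳ (suc n))))
binom-absorb zero (suc j) = *-zeroʳ (suc (suc j))
binom-absorb (suc n) (suc j) = begin
    suc (suc j) * (binom (suc n) (suc j) + binom (suc n) (suc (suc j)))
  ≡⟨ split (suc j) (binom (suc n) (suc j)) (binom (suc n) (suc (suc j))) ⟩
    suc j * binom (suc n) (suc j) + binom (suc n) (suc j) + suc (suc j) * binom (suc n) (suc (suc j))
  ≡⟨ cong₂ (λ a b → a + binom (suc n) (suc j) + b) (binom-absorb n j) (binom-absorb n (suc j)) ⟩
    suc n * binom n j + (binom n j + binom n (suc j)) + suc n * binom n (suc j)
  ≡⟨ merge (suc n) (binom n j) (binom n (suc j)) ⟩
    suc (suc n) * (binom n j + binom n (suc j)) ∎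
  where
  open ≡-Reasoning
  split : ∀ a x y → suc a * (x + y) ≡ a * x + x + suc a * y
  split = solve-∀
  merge : ∀ a x y → a * x + (x + y) + a * y ≡ suc a * (x + y)
  merge = solve-∀

-- Ratio of neighbours:  (j+1) binom(n, j+1) = (n-j) binom(n, j), in additive form.
binom-neighbours : ∀ n j → suc j * binom n (suc j) + suc j * binom n j ≡ suc n * binom n j
binom-neighbours n j = begin
    suc j * binom n (suc j) + suc j * binom n j
  ≡⟨ +-comm (suc j * binom n (suc j)) _ ⟩
    suc j * binom n j + suc j * binom n (suc j)
  ≡⟨ sym (*-distribˡ-+ (suc j) (binom n j) _) ⟩
    suc j * binom (suc n) (suc j)
  ≡⟨ binom-absorb n j ⟩
    suc n * binom n j ∎
  where open ≡-Reasoning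

module Ballot (k : ℕ) where

  -- ballot m h: walks with m up-steps starting h levels above the floor that
  -- reach the end level without going below the floor, counted by their first
  -- step (see count-walks).
  ballot : ℕ → ℕ → ℕ
  ballot zero h = 1
  ballot (suc m) zero = ballot m k
  ballot (suc m) (suc h) = ballot (suc m) h + ballot m (suc h + k)

  -- upSum f h = Σ_{i≤h} f (i + k): the contributions of the first up-step
  -- taken after an initial descent from height h to height h - i.
  upSum : (ℕ → ℕ) → ℕ → ℕ
  upSum f zero = f k
  upSum f (suc h) = upSum f h + f (suc h + k)

  ballotSum : ℕ → ℕ → ℕ
  ballotSum m zero = 0
  ballotSum m (suc h) = ballotSum m h + ballot m h

  -- gapTable r m h: total length of the r-th gap over the walks counted by
  -- ballot m h, the last gap being measured down to the floor (see
  -- count-gaps).  The (r+1)-th gap of a walk is the r-th gap of what follows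
  -- its first up-step.
  gapTable : ℕ → ℕ → ℕ → ℕ
  gapTable zero m h = ballotSum m h
  gapTable (suc r) zero h = 0
  gapTable (suc r) (suc m) h = upSum (gapTable r m) h

  upSum-cong : ∀ {f g} → (∀ x → f x ≡ g x) → ∀ h → upSum f h ≡ upSum g h
  upSum-cong eq zero = eq k
  upSum-cong eq (suc h) = cong₂ _+_ (upSum-cong eq h) (eq (suc h + k))

  upSum-+ : ∀ f g h → upSum (λ x → f x + g x) h ≡ upSum f h + upSum g h
  upSum-+ f g zero = refl
  upSum-+ f g (suc h) = begin
      upSum (λ x → f x + g x) h + (f (suc h + k) + g (suc h + k))
    ≡⟨ cong (λ z → z + (f (suc h + k) + g (suc h + k))) (upSum-+ f g h) ⟩
      upSum f h + upSum g h + (f (suc h + k) + g (suc h + k))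
    ≡⟨ interchange (upSum f h) (upSum g h) _ _ ⟩
      upSum f h + f (suc h + k) + (upSum g h + g (suc h + k)) ∎
    where
    open ≡-Reasoning
    interchange : ∀ a b c d → a + b + (c + d) ≡ a + c + (b + d)
    interchange = solve-∀

  upSum-*ʳ : ∀ f c h → upSum (λ x → f x * c) h ≡ upSum f h * c
  upSum-*ʳ f c zero = refl
  upSum-*ʳ f c (suc h) =
    trans (cong (_+ f (suc h + k) * c) (upSum-*ʳ f c h)) (sym (*-distribʳ-+ c (upSum f h) _))

  -- Deleting the first up-step: ballot (m+1) h = Σ_{i≤h} ballot m (i + k).
  upSum-ballot : ∀ m h → upSum (ballot m) h ≡ ballot (suc m) h
  upSum-ballot m zero = refl
  upSum-ballot m (suc h) = cong (_+ ballot m (suc h + k)) (upSum-ballot m h)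

  ballot-1 : ∀ h → ballot 1 h ≡ suc h
  ballot-1 zero = refl
  ballot-1 (suc h) = trans (cong (_+ 1) (ballot-1 h)) (+-comm (suc h) 1)

  ballotSum-0 : ∀ h → ballotSum 0 h ≡ h
  ballotSum-0 zero = refl
  ballotSum-0 (suc h) = trans (cong (_+ 1) (ballotSum-0 h)) (+-comm h 1)

  ballotSum-split : ∀ a h → ballotSum a (suc h + k) ≡ ballot (suc a) h + ballotSum a k
  ballotSum-split a zero = +-comm (ballotSum a k) _
  ballotSum-split a (suc h) = begin
      ballotSum a (suc h + k) + ballot a (suc h + k)
    ≡⟨ cong (_+ ballot a (suc h + k)) (ballotSum-split a h) ⟩
      ballot (suc a) h + ballotSum a k + ballot a (suc h + k)
    ≡⟨ swap (ballot (suc a) h) (ballotSum a k) _ ⟩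
      ballot (suc a) h + ballot a (suc h + k) + ballotSum a k ∎
    where
    open ≡-Reasoning
    swap : ∀ x y z → x + y + z ≡ x + z + y
    swap = solve-∀

  upSum-ballotSum : ∀ a h → upSum (ballotSum a) h ≡ ballotSum (suc a) h + ballot 1 h * ballotSum a k
  upSum-ballotSum a zero = sym (+-identityʳ (ballotSum a k))
  upSum-ballotSum a (suc h) = begin
      upSum (ballotSum a) h + ballotSum a (suc h + k)
    ≡⟨ cong₂ _+_ (upSum-ballotSum a h) (ballotSum-split a h) ⟩
      ballotSum (suc a) h + ballot 1 h * ballotSum a k + (ballot (suc a) h + ballotSum a k)
    ≡⟨ regroup (ballotSum (suc a) h) (ballot 1 h) (ballotSum a k) (ballot (suc a) h) ⟩
      ballotSum (suc a) h + ballot (suc a) h + (ballot 1 h + 1) * ballotSum a k ∎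
    where
    open ≡-Reasoning
    regroup : ∀ x y z w → x + y * z + (w + z) ≡ x + w + (y + 1) * z
    regroup = solve-∀

  gapTable-step : ∀ r a h →
    gapTable (suc r) (suc r + a) h ≡ gapTable r (suc r + a) h + ballot (suc r) h * ballotSum a k
  gapTable-step zero a h = upSum-ballotSum a h
  gapTable-step (suc r) a h = begin
      upSum (gapTable (suc r) (suc r + a)) h
    ≡⟨ upSum-cong (gapTable-step r a) h ⟩
      upSum (λ x → gapTable r (suc r + a) x + ballot (suc r) x * ballotSum a k) h
    ≡⟨ upSum-+ _ _ h ⟩
      gapTable (suc r) (suc (suc r) + a) h + upSum (λ x → ballot (suc r) x * ballotSum a k) h
    ≡⟨ cong (λ z → gapTable (suc r) (suc (suc r) + a) h + z) (upSum-*ʳ (ballot (suc r)) (ballotSum a k) h) ⟩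
      gapTable (suc r) (suc (suc r) + a) h + upSum (ballot (suc r)) h * ballotSum a k
    ≡⟨ cong (λ z → gapTable (suc r) (suc (suc r) + a) h + z * ballotSum a k) (upSum-ballot (suc r) h) ⟩
      gapTable (suc r) (suc (suc r) + a) h + ballot (suc (suc r)) h * ballotSum a k ∎
    where open ≡-Reasoning

  -- At the top row N = (k+1)(p+2) - 1 the neighbour ratio (N-p-1)/(p+2) is k.
  binom-top : ∀ p → binom (k + suc k * suc p) (suc (suc p)) ≡ k * binom (k + suc k * suc p) (suc p)
  binom-top p = *-cancelˡ-≡ _ _ (suc (suc p)) (+-cancelʳ-≡ (suc (suc p) * X) _ _ (begin
      suc (suc p) * binom N (suc (suc p)) + suc (suc p) * X
    ≡⟨ binom-neighbours N (suc p) ⟩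
      suc N * X
    ≡⟨ expand k p X ⟩
      suc (suc p) * (k * X) + suc (suc p) * X ∎))
    where
    open ≡-Reasoning
    N = k + suc k * suc p
    X = binom N (suc p)
    expand : ∀ k p X → suc (k + suc k * suc p) * X ≡ suc (suc p) * (k * X) + suc (suc p) * X
    expand = solve-∀

  -- Difference form of the ballot numbers:
  -- ballot (m+1) h = binom(h + (k+1)(m+1), m+1) - k binom(h + (k+1)(m+1), m).
  ballot-difference : ∀ m h →
    ballot (suc m) h + k * binom (h + suc k * suc m) m ≡ binom (h + suc k * suc m) (suc m)
  ballot-difference zero h = begin
      ballot 1 h + k * 1
    ≡⟨ cong (_+ k * 1) (ballot-1 h) ⟩
      suc h + k * 1
    ≡⟨ shape k h ⟩
      h + suc k * 1
    ≡⟨ sym (binom-1 (h + suc k * 1)) ⟩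
      binom (h + suc k * 1) 1 ∎
    where
    open ≡-Reasoning
    shape : ∀ k h → suc h + k * 1 ≡ h + suc k * 1
    shape = solve-∀
  ballot-difference (suc m) zero =
    subst (λ N → ballot (suc m) k + k * binom N (suc m) ≡ binom N (suc (suc m))) (sym (top-row k m)) (begin
      ballot (suc m) k + k * (binom R m + binom R (suc m))
    ≡⟨ regroup (ballot (suc m) k) k (binom R m) (binom R (suc m)) ⟩
      (ballot (suc m) k + k * binom R m) + k * binom R (suc m)
    ≡⟨ cong₂ _+_ (ballot-difference m k) (sym (binom-top m)) ⟩
      binom R (suc m) + binom R (suc (suc m)) ∎)
    where
    open ≡-Reasoning
    R = k + suc k * suc m
    top-row : ∀ k m → 0 + suc k * suc (suc m) ≡ suc (k + suc k * suc m)
    top-row = solve-∀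
    regroup : ∀ c k a b → c + k * (a + b) ≡ (c + k * a) + k * b
    regroup = solve-∀
  ballot-difference (suc m) (suc h) = begin
      ballot (suc (suc m)) h + ballot (suc m) (suc h + k) + k * (binom x m + binom x (suc m))
    ≡⟨ regroup (ballot (suc (suc m)) h) (ballot (suc m) (suc h + k)) k (binom x m) (binom x (suc m)) ⟩
      (ballot (suc (suc m)) h + k * binom x (suc m)) + (ballot (suc m) (suc h + k) + k * binom x m)
    ≡⟨ cong₂ _+_ (ballot-difference (suc m) h) shifted ⟩
      binom x (suc (suc m)) + binom x (suc m)
    ≡⟨ +-comm (binom x (suc (suc m))) _ ⟩
      binom x (suc m) + binom x (suc (suc m)) ∎
    where
    open ≡-Reasoning
    x = h + suc k * suc (suc m)
    same-row : ∀ k m h → suc h + k + suc k * suc m ≡ h + suc k * suc (suc m)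
    same-row = solve-∀
    shifted : ballot (suc m) (suc h + k) + k * binom x m ≡ binom x (suc m)
    shifted = subst (λ N → ballot (suc m) (suc h + k) + k * binom N m ≡ binom N (suc m))
                    (same-row k m h) (ballot-difference m (suc h + k))
    regroup : ∀ a b k c d → a + b + k * (c + d) ≡ (a + k * d) + (b + k * c)
    regroup = solve-∀

  ballot-product : ∀ p j → suc p * ballot (suc p) j ≡ suc j * binom (suc k * suc p + j) p
  ballot-product p j = +-cancelʳ-≡ (suc p * (k * X) + suc p * X) _ _ (begin
      suc p * c + (suc p * (k * X) + suc p * X)
    ≡⟨ factor p c k X ⟩
      suc p * (c + k * X) + suc p * X
    ≡⟨ cong (λ z → suc p * z + suc p * X) difference ⟩
      suc p * binom N (suc p) + suc p * X
    ≡⟨ binom-neighbours N p ⟩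
      suc N * X
    ≡⟨ expand p k j X ⟩
      suc j * X + (suc p * (k * X) + suc p * X) ∎)
    where
    open ≡-Reasoning
    N = suc k * suc p + j
    X = binom N p
    c = ballot (suc p) j
    difference : c + k * X ≡ binom N (suc p)
    difference = subst (λ M → c + k * binom M p ≡ binom M (suc p)) (+-comm j _) (ballot-difference p j)
    factor : ∀ p c k X → suc p * c + (suc p * (k * X) + suc p * X) ≡ suc p * (c + k * X) + suc p * X
    factor = solve-∀
    expand : ∀ p k j X → suc (suc k * suc p + j) * X ≡ suc j * X + (suc p * (k * X) + suc p * X)
    expand = solve-∀

  -- The closed form of the paper, cleared of its denominator:
  -- (j+1) binom((k+1)m + j + 1, m) = ballot m j ((k+1)m + j + 1).
  ballot-closed : ∀ m j → suc j * binom (suc (suc k * m + j)) m ≡ ballot m j * suc (suc k * m + j)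
  ballot-closed zero j = unit k j
    where
    unit : ∀ k j → suc j * 1 ≡ 1 * suc (suc k * 0 + j)
    unit = solve-∀
  ballot-closed (suc p) j = *-cancelˡ-≡ _ _ (suc p) (begin
      suc p * (suc j * binom (suc N) (suc p))
    ≡⟨ swap (suc p) (suc j) (binom (suc N) (suc p)) ⟩
      suc j * (suc p * binom (suc N) (suc p))
    ≡⟨ cong (suc j *_) (binom-absorb N p) ⟩
      suc j * (suc N * binom N p)
    ≡⟨ swap (suc j) (suc N) (binom N p) ⟩
      suc N * (suc j * binom N p)
    ≡⟨ cong (suc N *_) (sym (ballot-product p j)) ⟩
      suc N * (suc p * ballot (suc p) j)
    ≡⟨ rotate (suc N) (suc p) (ballot (suc p) j) ⟩
      suc p * (ballot (suc p) j * suc N) ∎)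
    where
    open ≡-Reasoning
    N = suc k * suc p + j
    swap : ∀ a b c → a * (b * c) ≡ b * (a * c)
    swap = solve-∀
    rotate : ∀ a b c → a * (b * c) ≡ b * (c * a)
    rotate = solve-∀

  Cnj≡ballot : ∀ m j → Cnj k m j ≡ ballot m j
  Cnj≡ballot m j = begin
      (suc j * (suc N C m)) / suc N
    ≡⟨ cong (λ z → (suc j * z) / suc N) (sym (binom≡C (suc N) m)) ⟩
      (suc j * binom (suc N) m) / suc N
    ≡⟨ cong (_/ suc N) (ballot-closed m j) ⟩
      (ballot m j * suc N) / suc N
    ≡⟨ m*n/n≡m (ballot m j) (suc N) ⟩
      ballot m j ∎
    where
    open ≡-Reasoning
    N = suc k * m + j

  ballotSum≡sumBelow : ∀ m h → ballotSum m h ≡ sumBelow h (Cnj k m)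
  ballotSum≡sumBelow m zero = refl
  ballotSum≡sumBelow m (suc h) =
    trans (cong₂ _+_ (ballotSum≡sumBelow m h) (sym (Cnj≡ballot m h))) (sym (sumBelow-suc h (Cnj k m)))

  -- The difference forms telescope:  with M = (k+1)(p+1),
  -- ballotSum (p+1) h = [binom(h+M, p+2) - k binom(h+M, p+1)] - [binom(M, p+2) - k binom(M, p+1)].
  ballotSum-telescope : ∀ p h → let M = suc k * suc p in
    ballotSum (suc p) h + binom M (suc (suc p)) + k * binom (h + M) (suc p)
      ≡ binom (h + M) (suc (suc p)) + k * binom M (suc p)
  ballotSum-telescope p zero = refl
  ballotSum-telescope p (suc h) = begin
      ballotSum (suc p) h + ballot (suc p) h + B₂ + k * (binom x p + binom x (suc p))
    ≡⟨ regroup (ballotSum (suc p) h) (ballot (suc p) h) B₂ k (binom x p) (binom x (suc p)) ⟩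
      (ballotSum (suc p) h + B₂ + k * binom x (suc p)) + (ballot (suc p) h + k * binom x p)
    ≡⟨ cong₂ _+_ (ballotSum-telescope p h) (ballot-difference p h) ⟩
      binom x (suc (suc p)) + k * B₁ + binom x (suc p)
    ≡⟨ rotate (binom x (suc (suc p))) (k * B₁) _ ⟩
      binom x (suc p) + binom x (suc (suc p)) + k * B₁ ∎
    where
    open ≡-Reasoning
    M = suc k * suc p
    x = h + M
    B₁ = binom M (suc p)
    B₂ = binom M (suc (suc p))
    regroup : ∀ q c b k w z → q + c + b + k * (w + z) ≡ (q + b + k * z) + (c + k * w)
    regroup = solve-∀
    rotate : ∀ y u z → y + u + z ≡ z + y + u
    rotate = solve-∀

  ballotSum-closed : ∀ m → suc m * ballotSum m k ≡ k * binom (suc k * m) m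
  ballotSum-closed zero = trans (+-identityʳ _) (trans (ballotSum-0 k) (sym (*-identityʳ k)))
  ballotSum-closed (suc p) = +-cancelʳ-≡ (suc M * X) _ _ (begin
      suc (suc p) * Q + suc M * X
    ≡⟨ cong (λ z → suc (suc p) * Q + z) (sym (binom-neighbours M (suc p))) ⟩
      suc (suc p) * Q + (suc (suc p) * B₂ + suc (suc p) * X)
    ≡⟨ factor (suc (suc p)) Q B₂ X ⟩
      suc (suc p) * (Q + B₂) + suc (suc p) * X
    ≡⟨ cong (λ z → suc (suc p) * z + suc (suc p) * X) top ⟩
      suc (suc p) * (k * X) + suc (suc p) * X
    ≡⟨ expand k p X ⟩
      k * X + suc M * X ∎)
    where
    open ≡-Reasoning
    M = suc k * suc p
    X = binom M (suc p)
    B₂ = binom M (suc (suc p))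
    Q = ballotSum (suc p) k
    Y = binom (k + M) (suc p)
    -- the telescope at h = k, where binom-top makes its top term vanish
    top : Q + B₂ ≡ k * X
    top = +-cancelʳ-≡ (k * Y) _ _
      (trans (ballotSum-telescope p k) (trans (cong (_+ k * X) (binom-top p)) (+-comm (k * Y) _)))
    factor : ∀ a q b x → a * q + (a * b + a * x) ≡ a * (q + b) + a * x
    factor = solve-∀
    expand : ∀ k p X → suc (suc p) * (k * X) + suc (suc p) * X ≡ k * X + suc (suc k * suc p) * X
    expand = solve-∀

module Counting (k t : ℕ) (t≤k : t ≤ k) where

  open Ballot k

  admissible : ℕ → ℕ → List Step → Bool
  admissible h m p = walkOK k t h p ∧ (ups p ≡ᵇ m)

  walkCount : ℕ → ℕ → List Step → ℕ
  walkCount h m p = guarded (admissible h m p) 1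

  gapCount : ℕ → ℕ → ℕ → List Step → ℕ
  gapCount r h m p = guarded (admissible h m p) (gap r p)

  -- The last gap stops t levels above the floor: the difference from gapTable.
  floorCorrection : ℕ → ℕ → ℕ → ℕ
  floorCorrection r m h = guarded (r ≡ᵇ m) (t * ballot r h)

  -- Admissible walks from height h with m up-steps have length L.  (A record,
  -- so that L, h and m can be inferred from it.)
  record Fits (L h m : ℕ) : Set where
    constructor fits
    field length-eq : L + t ≡ h + suc k * m

  -- The empty word has no up-steps (m ≥ 1 would force t > k).
  fits-empty-ups : ∀ {h m} → Fits 0 h (suc m) → ⊥
  fits-empty-ups {h} {m} (fits eq) = <⇒≱ (s≤s t≤k) (begin
      suc k             ≤⟨ m≤m+n (suc k) (suc k * m) ⟩
      suc k + suc k * m ≡⟨ *-suc (suc k) m ⟨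
      suc k * suc m     ≤⟨ m≤n+m _ h ⟩
      h + suc k * suc m ≡⟨ eq ⟨
      t                 ∎)
    where open ≤-Reasoning

  fits-empty-height : ∀ {h} → Fits 0 h 0 → h ≡ t
  fits-empty-height {h} (fits eq) =
    trans (sym (trans (cong (λ z → h + z) (*-zeroʳ (suc k))) (+-identityʳ h))) (sym eq)

  fits-floor : ∀ {L} → Fits (suc L) 0 0 → ⊥
  fits-floor (fits eq) = 1+n≢0 (trans eq (*-zeroʳ (suc k)))

  fits-down : ∀ {L h m} → Fits (suc L) (suc h) m → Fits L h m
  fits-down (fits eq) = fits (suc-injective eq)

  fits-up : ∀ {L h m} → Fits (suc L) h (suc m) → Fits L (h + k) m
  fits-up {L} {h} {m} (fits eq) = fits (suc-injective (trans eq (shape h k m)))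
    where
    shape : ∀ h k m → h + suc k * suc m ≡ suc (h + k + suc k * m)
    shape = solve-∀

  count-walks : ∀ L h m → Fits L h m → sumWords L (walkCount h m) ≡ ballot m h
  count-walks zero h zero fit rewrite fits-empty-height fit | ≡ᵇ-refl t = refl
  count-walks zero h (suc m) fit = ⊥-elim (fits-empty-ups fit)
  count-walks (suc L) zero zero fit = ⊥-elim (fits-floor fit)
  count-walks (suc L) (suc h) zero fit = begin
      sumWords (suc L) (walkCount (suc h) 0)
    ≡⟨ sumWords-step L (walkCount (suc h) 0) ⟩
      sumWords L (λ w → walkCount (suc h) 0 (up ∷ w) + walkCount h 0 w)
    ≡⟨ sumWords-cong L (λ w → cong (_+ walkCount h 0 w) (guarded-∧-false (walkOK k t (suc h + k) w) 1)) ⟩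
      sumWords L (walkCount h 0)
    ≡⟨ count-walks L h 0 (fits-down fit) ⟩
      1 ∎
    where open ≡-Reasoning
  count-walks (suc L) zero (suc m) fit = begin
      sumWords (suc L) (walkCount 0 (suc m))
    ≡⟨ sumWords-step L (walkCount 0 (suc m)) ⟩
      sumWords L (λ w → walkCount k m w + 0)
    ≡⟨ sumWords-cong L (λ w → +-identityʳ (walkCount k m w)) ⟩
      sumWords L (walkCount k m)
    ≡⟨ count-walks L k m (fits-up fit) ⟩
      ballot m k ∎
    where open ≡-Reasoning
  count-walks (suc L) (suc h) (suc m) fit = begin
      sumWords (suc L) (walkCount (suc h) (suc m))
    ≡⟨ sumWords-step L (walkCount (suc h) (suc m)) ⟩
      sumWords L (λ w → walkCount (suc h + k) m w + walkCount h (suc m) w)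
    ≡⟨ sumWords-+ L (walkCount (suc h + k) m) (walkCount h (suc m)) ⟩
      sumWords L (walkCount (suc h + k) m) + sumWords L (walkCount h (suc m))
    ≡⟨ cong₂ _+_ (count-walks L (suc h + k) m (fits-up fit)) (count-walks L h (suc m) (fits-down fit)) ⟩
      ballot m (suc h + k) + ballot (suc m) h
    ≡⟨ +-comm (ballot m (suc h + k)) _ ⟩
      ballot (suc m) (suc h) ∎
    where open ≡-Reasoning

  count-gaps : ∀ L r h m → Fits L h m →
               sumWords L (gapCount r h m) + floorCorrection r m h ≡ gapTable r m h
  count-gaps zero r h (suc m) fit = ⊥-elim (fits-empty-ups fit)
  count-gaps zero zero h zero fit rewrite fits-empty-height fit = begin
      guarded (admissible t 0 []) 0 + 0 + t * 1
    ≡⟨ cong (λ z → z + 0 + t * 1) (guarded-zero (admissible t 0 [])) ⟩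
      t * 1
    ≡⟨ *-identityʳ t ⟩
      t
    ≡⟨ ballotSum-0 t ⟨
      ballotSum 0 t ∎
    where open ≡-Reasoning
  count-gaps zero (suc r) h zero fit =
    trans (+-identityʳ _) (trans (+-identityʳ _) (guarded-zero (admissible h 0 [])))
  count-gaps (suc L) zero zero zero fit = ⊥-elim (fits-floor fit)
  count-gaps (suc L) zero zero (suc m) fit = begin
      sumWords (suc L) (gapCount 0 0 (suc m)) + 0
    ≡⟨ +-identityʳ _ ⟩
      sumWords (suc L) (gapCount 0 0 (suc m))
    ≡⟨ sumWords-step L (gapCount 0 0 (suc m)) ⟩
      sumWords L (λ w → guarded (admissible k m w) 0 + 0)
    ≡⟨ sumWords-cong L (λ w → trans (+-identityʳ _) (guarded-zero (admissible k m w))) ⟩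
      sumWords L (λ _ → 0)
    ≡⟨ sumWords-zero L ⟩
      0 ∎
    where open ≡-Reasoning
  count-gaps (suc L) zero (suc h) m fit = begin
      sumWords (suc L) (gapCount 0 (suc h) m) + corr
    ≡⟨ cong (_+ corr) (sumWords-step L (gapCount 0 (suc h) m)) ⟩
      sumWords L (λ w → gapCount 0 (suc h) m (up ∷ w) + guarded (admissible h m w) (suc (gap 0 w))) + corr
    ≡⟨ cong (_+ corr) (sumWords-cong L (λ w → cong₂ _+_ (guarded-zero (walkOK k t (suc h + k) w ∧ (suc (ups w) ≡ᵇ m)))
                                                          (guarded-suc (admissible h m w) (gap 0 w)))) ⟩
      sumWords L (λ w → walkCount h m w + gapCount 0 h m w) + corr
    ≡⟨ cong (_+ corr) (sumWords-+ L (walkCount h m) (gapCount 0 h m)) ⟩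
      sumWords L (walkCount h m) + sumWords L (gapCount 0 h m) + corr
    ≡⟨ +-assoc (sumWords L (walkCount h m)) _ _ ⟩
      sumWords L (walkCount h m) + (sumWords L (gapCount 0 h m) + corr)
    ≡⟨ cong₂ _+_ (count-walks L h m (fits-down fit)) (count-gaps L 0 h m (fits-down fit)) ⟩
      ballot m h + ballotSum m h
    ≡⟨ +-comm (ballot m h) _ ⟩
      ballotSum m (suc h) ∎
    where
    open ≡-Reasoning
    corr = floorCorrection 0 m h
  count-gaps (suc L) (suc r) h zero fit = begin
      sumWords (suc L) (gapCount (suc r) h 0) + 0
    ≡⟨ +-identityʳ _ ⟩
      sumWords (suc L) (gapCount (suc r) h 0)
    ≡⟨ sumWords-step L (gapCount (suc r) h 0) ⟩
      sumWords L (λ w → gapCount (suc r) h 0 (up ∷ w) + gapCount (suc r) h 0 (down ∷ w))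
    ≡⟨ sumWords-cong L (λ w → cong (_+ gapCount (suc r) h 0 (down ∷ w))
                                    (guarded-∧-false (walkOK k t (h + k) w) (gap r w))) ⟩
      sumWords L (λ w → gapCount (suc r) h 0 (down ∷ w))
    ≡⟨ descend h fit ⟩
      0 ∎
    where
    open ≡-Reasoning
    -- with no up-steps left only a descent is possible, and it has no r+1-th gap
    descend : ∀ h → Fits (suc L) h 0 → sumWords L (λ w → gapCount (suc r) h 0 (down ∷ w)) ≡ 0
    descend zero _ = sumWords-zero L
    descend (suc h) fit = trans (sym (+-identityʳ _)) (count-gaps L (suc r) h 0 (fits-down fit))
  count-gaps (suc L) (suc r) zero (suc m) fit = begin
      sumWords (suc L) (gapCount (suc r) 0 (suc m)) + corr
    ≡⟨ cong (_+ corr) (sumWords-step L (gapCount (suc r) 0 (suc m))) ⟩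
      sumWords L (λ w → gapCount r k m w + 0) + corr
    ≡⟨ cong (_+ corr) (sumWords-cong L (λ w → +-identityʳ (gapCount r k m w))) ⟩
      sumWords L (gapCount r k m) + corr
    ≡⟨ count-gaps L r k m (fits-up fit) ⟩
      gapTable r m k ∎
    where
    open ≡-Reasoning
    corr = floorCorrection r m k
  count-gaps (suc L) (suc r) (suc h) (suc m) fit = begin
      sumWords (suc L) (gapCount (suc r) (suc h) (suc m)) + floorCorrection (suc r) (suc m) (suc h)
    ≡⟨ cong₂ _+_ (sumWords-step L (gapCount (suc r) (suc h) (suc m))) corr-split ⟩
      sumWords L (λ w → gapCount r (suc h + k) m w + gapCount (suc r) h (suc m) w) + (c₁ + c₂)
    ≡⟨ cong (_+ (c₁ + c₂)) (sumWords-+ L (gapCount r (suc h + k) m) (gapCount (suc r) h (suc m))) ⟩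
      (g₁ + g₂) + (c₁ + c₂)
    ≡⟨ regroup g₁ g₂ c₁ c₂ ⟩
      (g₂ + c₁) + (g₁ + c₂)
    ≡⟨ cong₂ _+_ (count-gaps L (suc r) h (suc m) (fits-down fit)) (count-gaps L r (suc h + k) m (fits-up fit)) ⟩
      gapTable (suc r) (suc m) h + gapTable r m (suc h + k) ∎
    where
    open ≡-Reasoning
    g₁ = sumWords L (gapCount r (suc h + k) m)
    g₂ = sumWords L (gapCount (suc r) h (suc m))
    c₁ = floorCorrection (suc r) (suc m) h
    c₂ = floorCorrection r m (suc h + k)
    corr-split : floorCorrection (suc r) (suc m) (suc h) ≡ c₁ + c₂
    corr-split = trans (cong (guarded (r ≡ᵇ m)) (*-distribˡ-+ t (ballot (suc r) h) _))
                       (guarded-+ (r ≡ᵇ m) _ _)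
    regroup : ∀ a b c d → (a + b) + (c + d) ≡ (b + c) + (a + d)
    regroup = solve-∀

recurrence-in-ℤ : ∀ x y c q d → x + d * c ≡ y + c * q → + x ≡ + y +ℤ + c *ℤ (+ q -ℤ + d)
recurrence-in-ℤ x y c q d eq = begin
    + x
  ≡⟨ isolate (+ x) (+ d) (+ c) ⟩
    (+ x +ℤ + d *ℤ + c) -ℤ + d *ℤ + c
  ≡⟨ cong (λ z → z -ℤ + d *ℤ + c) lifted ⟩
    (+ y +ℤ + c *ℤ + q) -ℤ + d *ℤ + c
  ≡⟨ collect (+ y) (+ c) (+ q) (+ d) ⟩
    + y +ℤ + c *ℤ (+ q -ℤ + d) ∎
  where
  open ≡-Reasoning
  lifted : + x +ℤ + d *ℤ + c ≡ + y +ℤ + c *ℤ + q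
  lifted = begin
      + x +ℤ + d *ℤ + c  ≡⟨ cong (λ z → + x +ℤ z) (ℤ.pos-* d c) ⟨
      + x +ℤ + (d * c)   ≡⟨ ℤ.pos-+ x (d * c) ⟨
      + (x + d * c)      ≡⟨ cong +_ eq ⟩
      + (y + c * q)      ≡⟨ ℤ.pos-+ y (c * q) ⟩
      + y +ℤ + (c * q)   ≡⟨ cong (λ z → + y +ℤ z) (ℤ.pos-* c q) ⟩
      + y +ℤ + c *ℤ + q  ∎
  isolate : ∀ x d c → x ≡ (x +ℤ d *ℤ c) -ℤ d *ℤ c
  isolate = ℤ-Solver.solve-∀
  collect : ∀ y c q d → (y +ℤ c *ℤ q) -ℤ d *ℤ c ≡ y +ℤ c *ℤ (q -ℤ d)
  collect = ℤ-Solver.solve-∀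

≡ᵇ-suc-+ : ∀ r a → (r ≡ᵇ suc (r + a)) ≡ false
≡ᵇ-suc-+ zero a = refl
≡ᵇ-suc-+ (suc r) a = ≡ᵇ-suc-+ r a

module Gaps (k t : ℕ) (t≤k : t ≤ k) where

  open Ballot k
  open Counting k t t≤k

  s-corrected : ∀ n r → s k n t r + floorCorrection r n t ≡ gapTable r n t
  s-corrected n r = count-gaps (suc k * n) r t n (fits (+-comm (suc k * n) t))

  s-recurrence : ∀ r a → let n = suc r + a in
    s k n t (suc r) + guarded (suc r ≡ᵇ n) (t * ballot (suc r) t) ≡ s k n t r + ballot (suc r) t * ballotSum a k
  s-recurrence r a = begin
      s k n t (suc r) + floorCorrection (suc r) n t
    ≡⟨ s-corrected n (suc r) ⟩
      gapTable (suc r) n t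
    ≡⟨ gapTable-step r a t ⟩
      gapTable r n t + ballot (suc r) t * ballotSum a k
    ≡⟨ cong (_+ ballot (suc r) t * ballotSum a k) earlier-gap ⟩
      s k n t r + ballot (suc r) t * ballotSum a k ∎
    where
    open ≡-Reasoning
    n = suc r + a
    -- the r-th gap is not the last one, so it needs no correction
    earlier-gap : gapTable r n t ≡ s k n t r
    earlier-gap = begin
        gapTable r n t                          ≡⟨ s-corrected n r ⟨
        s k n t r + floorCorrection r n t       ≡⟨ cong (λ b → s k n t r + guarded b (t * ballot r t)) (≡ᵇ-suc-+ r a) ⟩
        s k n t r + 0                           ≡⟨ +-identityʳ _ ⟩
        s k n t r                               ∎

s-first-gap : ∀ k a → s k (suc a) 0 1 ≡ Ballot.ballotSum k a k
s-first-gap k a = begin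
    s k (suc a) 0 1
  ≡⟨ +-identityʳ _ ⟨
    s k (suc a) 0 1 + 0
  ≡⟨ cong (λ z → s k (suc a) 0 1 + z) (guarded-zero (0 ≡ᵇ a)) ⟨
    s k (suc a) 0 1 + Counting.floorCorrection k 0 z≤n 1 (suc a) 0
  ≡⟨ Gaps.s-corrected k 0 z≤n (suc a) 1 ⟩
    Ballot.ballotSum k a k ∎
  where open ≡-Reasoning

recurrence : ∀ k t → t ≤ k → ∀ r a → let n = suc r + a in
  + s k n t (suc r) ≡ + s k n t r
    +ℤ (+ Cnj k (suc r) t) *ℤ (+ s k (n ∸ suc r + 1) 0 1 -ℤ + (t * iver (suc r) n))
recurrence k t t≤k r a
  -- express C_{r+1,t} as a ballot number and s_{n-r,0,1} as ballotSum a k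
  rewrite Ballot.Cnj≡ballot k (suc r) t | m+n∸m≡n (suc r) a | +-comm a 1 | s-first-gap k a =
  recurrence-in-ℤ (s k n t (suc r)) (s k n t r) c (Ballot.ballotSum k a k) (t * iver (suc r) n) (begin
      s k n t (suc r) + t * iver (suc r) n * c
    ≡⟨ cong (λ z → s k n t (suc r) + z) (guarded-* (suc r ≡ᵇ n) t c) ⟨
      s k n t (suc r) + guarded (suc r ≡ᵇ n) (t * c)
    ≡⟨ Gaps.s-recurrence k t t≤k r a ⟩
      s k n t r + c * Ballot.ballotSum k a k ∎)
  where
  open ≡-Reasoning
  n = suc r + a
  c = Ballot.ballot k (suc r) t

theorem3p1 : (k t : ℕ) → 1 ≤ k → t ≤ k → (n : ℕ) → .{{_ : NonZero n}} →
    (s k n t 0 ≡ sumBelow t (Cnj k n))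
    × ((s k n 0 1 ≡ sumBelow k (Cnj k (n ∸ 1)))
       × (s k n 0 1 ≡ (k * ((suc k * (n ∸ 1)) C (n ∸ 1))) / n))
    × ((r : ℕ) → 1 ≤ r → r ≤ n →
         + s k n t r ≡ + s k n t (r ∸ 1)
           +ℤ (+ Cnj k r t) *ℤ (+ s k (n ∸ r + 1) 0 1 -ℤ + (t * iver r n)))
theorem3p1 k t _ t≤k (suc m) = first-gap , (first-gap-at-floor , first-gap-closed) , gap-recurrence
  where
  open Ballot k
  first-gap : s k (suc m) t 0 ≡ sumBelow t (Cnj k (suc m))
  first-gap = trans (sym (+-identityʳ _))
                    (trans (Gaps.s-corrected k t t≤k (suc m) 0) (ballotSum≡sumBelow (suc m) t))
  first-gap-at-floor : s k (suc m) 0 1 ≡ sumBelow k (Cnj k m)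
  first-gap-at-floor = trans (s-first-gap k m) (ballotSum≡sumBelow m k)
  first-gap-closed : s k (suc m) 0 1 ≡ (k * ((suc k * m) C m)) / suc m
  first-gap-closed = begin
      s k (suc m) 0 1                               ≡⟨ s-first-gap k m ⟩
      ballotSum m k                                 ≡⟨ m*n/n≡m (ballotSum m k) (suc m) ⟨
      (ballotSum m k * suc m) / suc m               ≡⟨ cong (_/ suc m) (*-comm (ballotSum m k) (suc m)) ⟩
      (suc m * ballotSum m k) / suc m               ≡⟨ cong (_/ suc m) (ballotSum-closed m) ⟩
      (k * binom (suc k * m) m) / suc m             ≡⟨ cong (λ z → (k * z) / suc m) (binom≡C (suc k * m) m) ⟩
      (k * ((suc k * m) C m)) / suc m               ∎
    where open ≡-Reasoning
  gap-recurrence : (r : ℕ) → 1 ≤ r → r ≤ suc m →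
    + s k (suc m) t r ≡ + s k (suc m) t (r ∸ 1)
      +ℤ (+ Cnj k r t) *ℤ (+ s k (suc m ∸ r + 1) 0 1 -ℤ + (t * iver r (suc m)))
  gap-recurrence (suc r) _ r≤n with m≤n⇒∃[o]m+o≡n r≤n
  ... | a , refl = recurrence k t t≤k r a
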